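{- Let $L$ be a finite trim lattice, let $\hat0=x_0\lessdot x_1\lessdot\cdots\lessdot x_n=\hat1$ be a maximal chain of left modular elements where $L$ has exactly $n$ join-irreducibles and $n$ meet-irreducibles, and for a join-irreducible $v$ let $\delta(v)=\min\{i: v\le x_i\}$. If $a,b_1,\dots,b_k$ are atoms of $L$ with $\delta(a)<\delta(b_1)<\cdots<\delta(b_k)$, then $a\not< b_1\vee\cdots\vee b_k$.
   Context: An element $x$ of a lattice $L$ is left modular if for all $y<z$ in $L$, $(y\vee x)\wedge z=y\vee(x\wedge z)$. A join-irreducible is an element other than $\hat0$ that is not the join of two strictly smaller elements; a meet-irreducible is an element other than $\hat1$ that is not the meet of two strictly larger elements. A lattice is trim if, for some $n$, it has a maximal chain of $n+1$ left modular elements and exactly $n$ join-irreducibles and exactly $n$ meet-irreducibles. Atoms (elements covering $\hat0$) are join-irreducible. -}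

module Defs where

open import Level using (Level; _⊔_)
open import Data.Nat using (ℕ; zero; suc)
open import Data.Fin using (Fin; zero; suc; fromℕ; inject₁; _<_)
open import Data.Product using (Σ; _×_; ∃; ∃-syntax)
open import Data.Sum using (_⊎_)
open import Relation.Nullary using (¬_)
open import Relation.Binary.PropositionalEquality using (_≡_)
open import Relation.Binary.Lattice.Bundles using (BoundedLattice)

module LatticeNotions {c ℓ₁ ℓ₂ : Level} (L : BoundedLattice c ℓ₁ ℓ₂) where
  open BoundedLattice L

  _≺_ : Carrier → Carrier → Set (ℓ₁ ⊔ ℓ₂)
  y ≺ z = (y ≤ z) × ¬ (y ≈ z)

  _⋖_ : Carrier → Carrier → Set (c ⊔ ℓ₁ ⊔ ℓ₂)
  y ⋖ z = (y ≺ z) × ¬ (∃[ w ] ((y ≺ w) × (w ≺ z)))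

  IsFinite : Set (c ⊔ ℓ₁)
  IsFinite = ∃[ m ] Σ (Fin m → Carrier) (λ f → ∀ x → ∃[ i ] (f i ≈ x))

  IsLeftModular : Carrier → Set (c ⊔ ℓ₁ ⊔ ℓ₂)
  IsLeftModular x = ∀ y z → y ≺ z → ((y ∨ x) ∧ z) ≈ (y ∨ (x ∧ z))

  IsJoinIrreducible : Carrier → Set (c ⊔ ℓ₁ ⊔ ℓ₂)
  IsJoinIrreducible x =
    ¬ (x ≈ ⊥) × ¬ (∃[ y ] ∃[ z ] ((y ≺ x) × (z ≺ x) × (x ≈ (y ∨ z))))

  IsMeetIrreducible : Carrier → Set (c ⊔ ℓ₁ ⊔ ℓ₂)
  IsMeetIrreducible x =
    ¬ (x ≈ ⊤) × ¬ (∃[ y ] ∃[ z ] ((x ≺ y) × (x ≺ z) × (x ≈ (y ∧ z))))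

  IsAtom : Carrier → Set (c ⊔ ℓ₁ ⊔ ℓ₂)
  IsAtom a = ⊥ ⋖ a

  HasExactly : ∀ {p} → ℕ → (Carrier → Set p) → Set (c ⊔ ℓ₁ ⊔ p)
  HasExactly n P = Σ (Fin n → Carrier) λ e →
      (∀ i → P (e i))
    × (∀ i j → e i ≈ e j → i ≡ j)
    × (∀ x → P x → ∃[ i ] (e i ≈ x))

  IsMaxLeftModularChain : (n : ℕ) → (Fin (suc n) → Carrier) → Set (c ⊔ ℓ₁ ⊔ ℓ₂)
  IsMaxLeftModularChain n x =
      (x zero ≈ ⊥)
    × (x (fromℕ n) ≈ ⊤)
    × (∀ (i : Fin n) → x (inject₁ i) ⋖ x (suc i))
    × (∀ i → IsLeftModular (x i))

  IsDelta : ∀ {n} → (Fin (suc n) → Carrier) → Carrier → Fin (suc n) → Set ℓ₂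
  IsDelta x v i = (v ≤ x i) × (∀ j → j < i → ¬ (v ≤ x j))

  bigJoin : ∀ {k} → (Fin k → Carrier) → Carrier
  bigJoin {zero} b = ⊥
  bigJoin {suc k} b = b zero ∨ bigJoin (λ i → b (suc i))

{-# OPTIONS --safe #-}
-- Let c = δ(a). No bᵢ lies below x_c, and adding the atoms one at a time keeps
-- x_c ∧ (b₁ ∨ ⋯ ∨ bₖ) = 0̂; since a ≤ x_c, a ≤ b₁ ∨ ⋯ ∨ bₖ would force a = 0̂.
-- For the step from Y to Z = b ∨ Y, suppose x_c ∧ Z ≠ 0̂ and take i with
-- x_i ∧ Z = 0̂ ≠ x_{i+1} ∧ Z. The cover x_i ⋖ x_{i+1} gives x_{i+1} ≤ Z ∨ x_i,
-- while left modularity of x_i puts b ∨ x_i and Y ∨ x_i into the band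
-- {w : x_i ≤ w, x_{i+1} ≰ w}. Maximal elements of a band are meet-irreducible
-- and lie in no other band, so with n bands and at most n meet-irreducibles
-- every band has a greatest element; bands are therefore closed under joins,
-- contradicting x_{i+1} ≤ (b ∨ x_i) ∨ (Y ∨ x_i).
-- Only δ(a) < δ(bᵢ) is used: neither the ordering of the δ(bᵢ) nor the number
-- of join-irreducibles. Order is decidable in a finite lattice only up to double
-- negation, which suffices for the negative conclusion.
module Submission where

open import Defs
open import Level using (Level)
open import Data.Nat using (ℕ; suc)
open import Data.Fin using (Fin; zero; suc; _<_)
open import Data.Product using (_×_)
open import Relation.Nullary using (¬_)
open import Relation.Binary.Lattice.Bundles using (BoundedLattice)

import Data.Nat as ℕ
open import Data.Nat.Properties using (1+n≰n)
import Data.Fin as Fin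
open import Data.Fin using (inject₁; toℕ; punchOut)
open import Data.Fin.Properties
  using (_≟_; any?; injective⇒≤; punchOut-injective; toℕ-inject₁; <-cmp; sequence)
open import Data.Product using (∃-syntax; _,_; proj₁; proj₂; uncurry)
open import Effect.Monad using (RawMonad)
open import Function using (_∘_)
open import Function.Definitions using (Injective)
open import Relation.Binary.Bundles using (Preorder)
open import Relation.Binary.Definitions using (Decidable; _Respects_; tri<; tri≈; tri>)
open import Relation.Binary.PropositionalEquality using (_≡_; sym; subst)
open import Relation.Nullary using (Dec; yes; no; ¬?)
open import Relation.Nullary.Decidable using (_×-dec_; map′; decidable-stable; ¬¬-excluded-middle)
open import Relation.Nullary.Negation using (¬¬-Monad; ¬¬-map; contradiction)
import Relation.Unary as U
import Relation.Binary.Lattice.Properties.JoinSemilattice as JoinProperties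
import Relation.Binary.Lattice.Properties.MeetSemilattice as MeetProperties
import Relation.Binary.Reasoning.PartialOrder as PosetReasoning

crossing-step : ∀ {p n} {P : Fin (suc n) → Set p} → U.Decidable P → P zero →
                ∀ {c} → ¬ P c → ∃[ i ] P (inject₁ i) × ¬ P (suc i) × suc i Fin.≤ c
crossing-step P? p₀ {zero} ¬p₀ = contradiction p₀ ¬p₀
crossing-step {n = suc n} P? p₀ {suc c} ¬pc with P? (suc zero)
... | no ¬p₁ = zero , p₀ , ¬p₁ , ℕ.s≤s ℕ.z≤n
... | yes p₁ =
  let i , pᵢ , ¬pᵢ₊₁ , i<c = crossing-step (P? ∘ suc) p₁ ¬pc
  in suc i , pᵢ , ¬pᵢ₊₁ , ℕ.s≤s i<c

injective⇒surjective : ∀ {n} {g : Fin n → Fin n} → Injective _≡_ _≡_ g →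
                       ∀ t → ∃[ j ] g j ≡ t
injective⇒surjective {suc n} {g} g-inj t with any? (λ j → g j ≟ t)
... | yes hit = hit
... | no miss = contradiction (injective⇒≤ g-avoiding-t-injective) 1+n≰n
  where
  t≢g : ∀ j → ¬ t ≡ g j
  t≢g j t≡gj = miss (j , sym t≡gj)

  g-avoiding-t : Fin (suc n) → Fin n
  g-avoiding-t j = punchOut (t≢g j)

  g-avoiding-t-injective : Injective _≡_ _≡_ g-avoiding-t
  g-avoiding-t-injective = g-inj ∘ punchOut-injective (t≢g _) (t≢g _)

module _ {c ℓ₁ ℓ₂} (P : Preorder c ℓ₁ ℓ₂) where
  open Preorder P

  chain-monotone : ∀ {n} (x : Fin (suc n) → Carrier) → (∀ i → x (inject₁ i) ≲ x (suc i)) →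
                   ∀ {p q} → p Fin.≤ q → x p ≲ x q
  chain-monotone x step {zero} {zero} _ = refl
  chain-monotone {suc n} x step {zero} {suc q} _ =
    trans (step zero) (chain-monotone (x ∘ suc) (step ∘ suc) {zero} {q} ℕ.z≤n)
  chain-monotone {suc n} x step {suc p} {suc q} (ℕ.s≤s p≤q) =
    chain-monotone (x ∘ suc) (step ∘ suc) p≤q

  enumerated⇒¬¬decidable : ∀ {m} (f : Fin m → Carrier) → (∀ y → ∃[ i ] f i ≈ y) →
                           ¬ ¬ Decidable _≲_
  enumerated⇒¬¬decidable f onto =
    ¬¬-map decide (sequence¬¬ λ i → sequence¬¬ λ j → ¬¬-excluded-middle)
    where
    sequence¬¬ : ∀ {n} {A : U.Pred (Fin n) ℓ₂} → (∀ i → ¬ ¬ A i) → ¬ ¬ (∀ i → A i)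
    sequence¬¬ = sequence (RawMonad.rawApplicative ¬¬-Monad)

    decide : (∀ i j → Dec (f i ≲ f j)) → Decidable _≲_
    decide d y z =
      let i , fi≈y = onto y
          j , fj≈z = onto z
      in map′ (λ fi≲fj → ≲-respʳ-≈ fj≈z (≲-respˡ-≈ fi≈y fi≲fj))
              (λ y≲z → ≲-respʳ-≈ (Eq.sym fj≈z) (≲-respˡ-≈ (Eq.sym fi≈y) y≲z))
              (d i j)

  module _ (_≲?_ : Decidable _≲_) {q} {Q : Carrier → Set q} (Q? : U.Decidable Q) where

    maximal-above-enumerated :
      ∀ {m} (f : Fin m → Carrier) {w} → Q w →
      ∃[ M ] Q M × w ≲ M × (∀ j → Q (f j) → M ≲ f j → f j ≲ M)
    maximal-above-enumerated {ℕ.zero} f {w} qw = w , qw , refl , λ ()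
    maximal-above-enumerated {suc m} f {w} qw with Q? (f zero) ×-dec w ≲? f zero
    ... | yes (qf₀ , w≲f₀) =
      let M , qM , f₀≲M , max = maximal-above-enumerated (f ∘ suc) qf₀
      in M , qM , trans w≲f₀ f₀≲M , λ { zero _ _ → f₀≲M ; (suc j) → max j }
    ... | no ¬jump =
      let M , qM , w≲M , max = maximal-above-enumerated (f ∘ suc) qw
      in M , qM , w≲M ,
         λ { zero qf₀ M≲f₀ → contradiction (qf₀ , trans w≲M M≲f₀) ¬jump ; (suc j) → max j }

    maximal-above : ∀ {m} (f : Fin m → Carrier) → (∀ y → ∃[ i ] f i ≈ y) →
                    Q Respects _≈_ → ∀ {w} → Q w →
                    ∃[ M ] Q M × w ≲ M × (∀ {t} → Q t → M ≲ t → t ≲ M)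
    maximal-above f onto Q-resp qw =
      let M , qM , w≲M , max = maximal-above-enumerated f qw
          maximal : ∀ {t} → Q t → M ≲ t → t ≲ M
          maximal {t} qt M≲t =
            let j , fj≈t = onto t
            in ≲-respˡ-≈ fj≈t (max j (Q-resp (Eq.sym fj≈t) qt) (≲-respʳ-≈ (Eq.sym fj≈t) M≲t))
      in M , qM , w≲M , maximal

module _ {c ℓ₁ ℓ₂} (L : BoundedLattice c ℓ₁ ℓ₂) where
  open BoundedLattice L
  open LatticeNotions L
  open JoinProperties joinSemilattice using (∨-monotonic)
  open MeetProperties meetSemilattice using (∧-monotonic)
  open PosetReasoning poset

  module _ (_≤?_ : Decidable _≤_) where

    _≈?_ : Decidable _≈_
    y ≈? z = map′ (uncurry antisym) (λ y≈z → reflexive y≈z , reflexive (Eq.sym y≈z))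
                  (y ≤? z ×-dec z ≤? y)

    atom-∧-⊥ : ∀ {b u} → IsAtom b → ¬ b ≤ u → b ∧ u ≤ ⊥
    atom-∧-⊥ {b} {u} (_ , nothing-between) b≰u =
      decidable-stable ((b ∧ u) ≤? ⊥) λ b∧u≰⊥ →
        nothing-between (b ∧ u ,
          (minimum _ , λ ⊥≈b∧u → b∧u≰⊥ (reflexive (Eq.sym ⊥≈b∧u))) ,
          (x∧y≤x b u , λ b∧u≈b → b≰u (trans (reflexive (Eq.sym b∧u≈b)) (x∧y≤y b u))))

    ⋖-squeeze : ∀ {y z w} → y ⋖ z → y ≤ w → w ≤ z → ¬ y ≈ w → z ≤ w
    ⋖-squeeze (_ , nothing-between) y≤w w≤z y≉w =
      decidable-stable (_ ≤? _) λ z≰w →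
        nothing-between (_ , (y≤w , y≉w) , (w≤z , λ w≈z → z≰w (reflexive (Eq.sym w≈z))))

    leftModular-≤ : ∀ {m y z} → IsLeftModular m → y ≤ z → (y ∨ m) ∧ z ≤ y ∨ (m ∧ z)
    leftModular-≤ {m} {y} {z} m-mod y≤z with y ≈? z
    ... | yes y≈z = trans (x∧y≤y _ z) (trans (reflexive (Eq.sym y≈z)) (x≤x∨y y _))
    ... | no y≉z = reflexive (m-mod y z (y≤z , y≉z))

    maximal-avoiding⇒meetIrreducible :
      ∀ {p M} → ¬ p ≤ M → (∀ {t} → M ≤ t → ¬ p ≤ t → t ≤ M) → IsMeetIrreducible M
    maximal-avoiding⇒meetIrreducible {p} {M} p≰M maximal =
        (λ M≈⊤ → p≰M (trans (maximum p) (reflexive (Eq.sym M≈⊤))))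
      , λ (y , z , M≺y , M≺z , M≈y∧z) →
          p≰M (trans (∧-greatest (p≤ M≺y) (p≤ M≺z)) (reflexive (Eq.sym M≈y∧z)))
      where
      p≤ : ∀ {t} → M ≺ t → p ≤ t
      p≤ (M≤t , M≉t) = decidable-stable (p ≤? _) λ p≰t → M≉t (antisym M≤t (maximal M≤t p≰t))

    module _ {k} (enum : Fin k → Carrier) (enum-onto : ∀ y → ∃[ j ] enum j ≈ y)
             {n} {x : Fin (suc n) → Carrier} (x-covers : ∀ i → x (inject₁ i) ⋖ x (suc i))
             (m : Fin n → Carrier) (m-complete : ∀ w → IsMeetIrreducible w → ∃[ t ] m t ≈ w)
             where

      x-step : ∀ i → x (inject₁ i) ≤ x (suc i)
      x-step i = proj₁ (proj₁ (x-covers i))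

      x-monotone : ∀ {p q} → p Fin.≤ q → x p ≤ x q
      x-monotone = chain-monotone preorder x x-step

      Band : Fin n → Carrier → Set ℓ₂
      Band i w = x (inject₁ i) ≤ w × ¬ x (suc i) ≤ w

      Band? : ∀ i → U.Decidable (Band i)
      Band? i w = x (inject₁ i) ≤? w ×-dec ¬? (x (suc i) ≤? w)

      Band-resp : ∀ i → Band i Respects _≈_
      Band-resp i w≈v (xᵢ≤w , xᵢ₊₁≰w) =
        trans xᵢ≤w (reflexive w≈v) , λ xᵢ₊₁≤v → xᵢ₊₁≰w (trans xᵢ₊₁≤v (reflexive (Eq.sym w≈v)))

      xᵢ∈Band : ∀ i → Band i (x (inject₁ i))
      xᵢ∈Band i = refl , λ xᵢ₊₁≤xᵢ → proj₂ (proj₁ (x-covers i)) (antisym (x-step i) xᵢ₊₁≤xᵢ)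

      Band-disjoint : ∀ {i j w} → i < j → Band i w → ¬ Band j w
      Band-disjoint {i} {j} i<j (_ , xᵢ₊₁≰w) (xⱼ≤w , _) = xᵢ₊₁≰w (trans (x-monotone 1+i≤j) xⱼ≤w)
        where
        1+i≤j : suc i Fin.≤ inject₁ j
        1+i≤j = subst (suc (toℕ i) ℕ.≤_) (sym (toℕ-inject₁ j)) i<j

      Band-unique : ∀ {i j w} → Band i w → Band j w → i ≡ j
      Band-unique {i} {j} wᵢ wⱼ with <-cmp i j
      ... | tri< i<j _ _ = contradiction wⱼ (Band-disjoint i<j wᵢ)
      ... | tri≈ _ i≡j _ = i≡j
      ... | tri> _ _ j<i = contradiction wᵢ (Band-disjoint j<i wⱼ)

      Band-meetIrreducible-above : ∀ {i w} → Band i w → ∃[ t ] Band i (m t) × w ≤ m t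
      Band-meetIrreducible-above {i} wᵢ =
        let M , Mᵢ , w≤M , maximal =
              maximal-above preorder _≤?_ (Band? i) enum enum-onto (Band-resp i) wᵢ
            avoiding : ∀ {t} → M ≤ t → ¬ x (suc i) ≤ t → t ≤ M
            avoiding M≤t xᵢ₊₁≰t = maximal (trans (proj₁ Mᵢ) M≤t , xᵢ₊₁≰t) M≤t
            t , mt≈M = m-complete M (maximal-avoiding⇒meetIrreducible (proj₂ Mᵢ) avoiding)
        in t , Band-resp i (Eq.sym mt≈M) Mᵢ , trans w≤M (reflexive (Eq.sym mt≈M))

      top : Fin n → Fin n
      top i = proj₁ (Band-meetIrreducible-above (xᵢ∈Band i))

      top∈Band : ∀ i → Band i (m (top i))
      top∈Band i = proj₁ (proj₂ (Band-meetIrreducible-above (xᵢ∈Band i)))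

      top-injective : Injective _≡_ _≡_ top
      top-injective {i} {j} topᵢ≡topⱼ =
        Band-unique (top∈Band i) (subst (Band j ∘ m) (sym topᵢ≡topⱼ) (top∈Band j))

      -- The count of meet-irreducibles enters here: top is injective, hence onto.
      Band-bounded : ∀ {i w} → Band i w → w ≤ m (top i)
      Band-bounded {i} {w} wᵢ =
        let t , mt∈Bandᵢ , w≤mt = Band-meetIrreducible-above wᵢ
            j , topⱼ≡t = injective⇒surjective top-injective t
            j≡i = Band-unique (subst (Band j ∘ m) topⱼ≡t (top∈Band j)) mt∈Bandᵢ
        in subst (λ j → w ≤ m (top j)) j≡i (subst (λ s → w ≤ m s) (sym topⱼ≡t) w≤mt)

      Band-∨-closed : ∀ {i w₁ w₂} → Band i w₁ → Band i w₂ → Band i (w₁ ∨ w₂)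
      Band-∨-closed {i} w₁ᵢ w₂ᵢ =
          trans (proj₁ w₁ᵢ) (x≤x∨y _ _)
        , λ xᵢ₊₁≤w₁∨w₂ → proj₂ (top∈Band i)
                           (trans xᵢ₊₁≤w₁∨w₂ (∨-least (Band-bounded w₁ᵢ) (Band-bounded w₂ᵢ)))

      module _ (x₀≈⊥ : x zero ≈ ⊥) (x-leftModular : ∀ i → IsLeftModular (x i)) where

        module _ {i : Fin n} {Z : Carrier}
                 (xᵢ∧Z≤⊥ : x (inject₁ i) ∧ Z ≤ ⊥) (xᵢ₊₁∧Z≰⊥ : ¬ x (suc i) ∧ Z ≤ ⊥) where

          xᵢ₊₁≤Z∨xᵢ : x (suc i) ≤ Z ∨ x (inject₁ i)
          xᵢ₊₁≤Z∨xᵢ = begin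
            x (suc i)
              ≤⟨ ⋖-squeeze (x-covers i) (y≤x∨y _ _) [xᵢ₊₁∧Z]∨xᵢ≤xᵢ₊₁ xᵢ≉[xᵢ₊₁∧Z]∨xᵢ ⟩
            (x (suc i) ∧ Z) ∨ x (inject₁ i)
              ≤⟨ ∨-monotonic (x∧y≤y _ _) refl ⟩
            Z ∨ x (inject₁ i)
              ∎
            where
            [xᵢ₊₁∧Z]∨xᵢ≤xᵢ₊₁ : (x (suc i) ∧ Z) ∨ x (inject₁ i) ≤ x (suc i)
            [xᵢ₊₁∧Z]∨xᵢ≤xᵢ₊₁ = ∨-least (x∧y≤x _ _) (x-step i)

            xᵢ≉[xᵢ₊₁∧Z]∨xᵢ : ¬ x (inject₁ i) ≈ (x (suc i) ∧ Z) ∨ x (inject₁ i)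
            xᵢ≉[xᵢ₊₁∧Z]∨xᵢ xᵢ≈[xᵢ₊₁∧Z]∨xᵢ =
              xᵢ₊₁∧Z≰⊥ (trans (∧-greatest xᵢ₊₁∧Z≤xᵢ (x∧y≤y _ _)) xᵢ∧Z≤⊥)
              where
              xᵢ₊₁∧Z≤xᵢ : x (suc i) ∧ Z ≤ x (inject₁ i)
              xᵢ₊₁∧Z≤xᵢ = trans (x≤x∨y _ _) (reflexive (Eq.sym xᵢ≈[xᵢ₊₁∧Z]∨xᵢ))

          ∨xᵢ∈Band : ∀ {u} → u ≤ Z → x (suc i) ∧ u ≤ ⊥ → Band i (u ∨ x (inject₁ i))
          ∨xᵢ∈Band {u} u≤Z xᵢ₊₁∧u≤⊥ =
              y≤x∨y _ _
            , λ xᵢ₊₁≤u∨xᵢ →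
                xᵢ₊₁∧Z≰⊥ (trans (∧-greatest (x∧y≤x _ _) (xᵢ₊₁∧Z≤u xᵢ₊₁≤u∨xᵢ)) xᵢ₊₁∧u≤⊥)
            where
            xᵢ₊₁∧Z≤u : x (suc i) ≤ u ∨ x (inject₁ i) → x (suc i) ∧ Z ≤ u
            xᵢ₊₁∧Z≤u xᵢ₊₁≤u∨xᵢ = begin
              x (suc i) ∧ Z                ≤⟨ ∧-monotonic xᵢ₊₁≤u∨xᵢ refl ⟩
              (u ∨ x (inject₁ i)) ∧ Z      ≤⟨ leftModular-≤ (x-leftModular (inject₁ i)) u≤Z ⟩
              u ∨ (x (inject₁ i) ∧ Z)      ≤⟨ ∨-least refl (trans xᵢ∧Z≤⊥ (minimum u)) ⟩
              u                            ∎

        ∧-∨-atom-⊥ : ∀ {c b Y} → IsAtom b → ¬ b ≤ x c → x c ∧ Y ≤ ⊥ → x c ∧ (b ∨ Y) ≤ ⊥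
        ∧-∨-atom-⊥ {c} {b} {Y} b-atom b≰xc xc∧Y≤⊥ =
          decidable-stable ((x c ∧ (b ∨ Y)) ≤? ⊥) λ xc∧Z≰⊥ →
            let i , xᵢ∧Z≤⊥ , xᵢ₊₁∧Z≰⊥ , 1+i≤c =
                  crossing-step (λ q → (x q ∧ (b ∨ Y)) ≤? ⊥) x₀∧Z≤⊥ xc∧Z≰⊥
            in no-crossing-below i xᵢ∧Z≤⊥ xᵢ₊₁∧Z≰⊥ (x-monotone 1+i≤c)
          where
          x₀∧Z≤⊥ : x zero ∧ (b ∨ Y) ≤ ⊥
          x₀∧Z≤⊥ = trans (x∧y≤x _ _) (reflexive x₀≈⊥)

          no-crossing-below : ∀ i → x (inject₁ i) ∧ (b ∨ Y) ≤ ⊥ → ¬ x (suc i) ∧ (b ∨ Y) ≤ ⊥ →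
                              ¬ x (suc i) ≤ x c
          no-crossing-below i xᵢ∧Z≤⊥ xᵢ₊₁∧Z≰⊥ xᵢ₊₁≤xc =
            proj₂ (Band-∨-closed b∨xᵢ∈Band Y∨xᵢ∈Band) (begin
              x (suc i)                                  ≤⟨ xᵢ₊₁≤Z∨xᵢ xᵢ∧Z≤⊥ xᵢ₊₁∧Z≰⊥ ⟩
              (b ∨ Y) ∨ x (inject₁ i)                    ≤⟨ regroup ⟩
              (b ∨ x (inject₁ i)) ∨ (Y ∨ x (inject₁ i))  ∎)
            where
            b∨xᵢ∈Band : Band i (b ∨ x (inject₁ i))
            b∨xᵢ∈Band = ∨xᵢ∈Band xᵢ∧Z≤⊥ xᵢ₊₁∧Z≰⊥ (x≤x∨y b Y)
              (trans (∧-greatest (x∧y≤y _ _) (trans (x∧y≤x _ _) xᵢ₊₁≤xc)) (atom-∧-⊥ b-atom b≰xc))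

            Y∨xᵢ∈Band : Band i (Y ∨ x (inject₁ i))
            Y∨xᵢ∈Band = ∨xᵢ∈Band xᵢ∧Z≤⊥ xᵢ₊₁∧Z≰⊥ (y≤x∨y b Y)
              (trans (∧-monotonic xᵢ₊₁≤xc refl) xc∧Y≤⊥)

            regroup : (b ∨ Y) ∨ x (inject₁ i) ≤ (b ∨ x (inject₁ i)) ∨ (Y ∨ x (inject₁ i))
            regroup = ∨-least (∨-monotonic (x≤x∨y _ _) (x≤x∨y _ _)) (trans (y≤x∨y b _) (x≤x∨y _ _))

        ∧-bigJoin-atoms-⊥ : ∀ {c k} (b : Fin k → Carrier) →
                            (∀ l → IsAtom (b l)) → (∀ l → ¬ b l ≤ x c) → x c ∧ bigJoin b ≤ ⊥
        ∧-bigJoin-atoms-⊥ {k = ℕ.zero} b _ _ = x∧y≤y _ _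
        ∧-bigJoin-atoms-⊥ {k = suc k} b b-atoms b≰xc =
          ∧-∨-atom-⊥ (b-atoms zero) (b≰xc zero)
            (∧-bigJoin-atoms-⊥ (b ∘ suc) (b-atoms ∘ suc) (b≰xc ∘ suc))

theorem5 : ∀ {c ℓ₁ ℓ₂ : Level} (L : BoundedLattice c ℓ₁ ℓ₂) →
    let open BoundedLattice L
        open LatticeNotions L
    in IsFinite →
       (n : ℕ) (x : Fin (suc n) → Carrier) →
       IsMaxLeftModularChain n x →
       HasExactly n IsJoinIrreducible →
       HasExactly n IsMeetIrreducible →
       (k : ℕ) (a : Carrier) (b : Fin k → Carrier) →
       IsAtom a → (∀ i → IsAtom (b i)) →
       (da : Fin (suc n)) → IsDelta x a da →
       (db : Fin k → Fin (suc n)) → (∀ i → IsDelta x (b i) (db i)) →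
       (∀ i → da < db i) →
       (∀ i j → i < j → db i < db j) →
       ¬ (a ≺ bigJoin b)
theorem5 L (_ , enum , enum-onto) n x (x₀≈⊥ , _ , x-covers , x-leftModular)
         _ (m , _ , _ , m-complete)
         k a b a-atom b-atoms da (a≤xda , _) db δb da<db _ (a≤⋁b , _) =
  enumerated⇒¬¬decidable preorder enum enum-onto λ _≤?_ →
    let b≰xda : ∀ l → ¬ b l ≤ x da
        b≰xda l = proj₂ (δb l) da (da<db l)
        xda∧⋁b≤⊥ : x da ∧ bigJoin b ≤ ⊥
        xda∧⋁b≤⊥ = ∧-bigJoin-atoms-⊥ L _≤?_ enum enum-onto x-covers m m-complete x₀≈⊥ x-leftModular
                     b b-atoms b≰xda
    in proj₂ (proj₁ a-atom) (antisym (minimum a) (trans (∧-greatest a≤xda a≤⋁b) xda∧⋁b≤⊥))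
  where
  open BoundedLattice L
  open LatticeNotions L using (bigJoin)
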